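{- For every positive integer $k$ there exist a graph $G$ and a configuration $C_0$ of $G$ such that the $\frac12$-power index process with initial configuration $C_0$ eventually becomes periodic with period at least $k$.
   Context: All graphs are finite and simple. A configuration of a graph $G$ is a map $C:V(G)\to\{C,D\}$; vertices with value $C$ are collaborators, those with value $D$ defectors. $N[v]$ is the closed neighbourhood of $v$, $N_C[v]$ is the set of collaborators in $N[v]$ and $N_D[v]$ the set of defectors in $N[v]$. For $w=\frac12$, the power of $v$ is: if $v$ is a collaborator, $p(v)=1/|N_C[v]|$ when $|N_C[v]|/|N[v]|>w$ and $0$ otherwise; if $v$ is a defector, $p(v)=1/|N_D[v]|$ when $|N_C[v]|/|N[v]|\le w$ and $0$ otherwise. The $w$-power index process produces $C_1,C_2,\dots$ from $C_0$: for $t\ge1$ each vertex $v$ simultaneously takes the strategy that, in $C_{t-1}$, is held by the vertex of $N[v]$ of greatest power (computed w.r.t. $C_{t-1}$); if the vertices of $N[v]$ of greatest power have differing strategies, $C_t(v)=C_{t-1}(v)$. The process becomes periodic with period $\ell$ if $\ell>1$ is the least integer such that $C_i=C_{i+\ell}$ for some $i\ge0$. -}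

module Defs where

open import Data.Bool using (Bool; true; false; _∨_; _∧_; if_then_else_; not)
open import Data.Nat as ℕ using (ℕ; zero; suc; _<_; _≥_; _*_)
open import Data.Nat.Properties using (_<?_)
open import Data.Fin using (Fin)
open import Data.Fin.Properties using () renaming (_≟_ to _≟F_)
open import Data.List using (List; filterᵇ; length; map; foldr; []; _∷_)
open import Data.List.Base using (allFin)
open import Data.Integer using (+_)
open import Data.Rational using (ℚ; _/_; 0ℚ; _⊔_)
open import Data.Rational.Properties using () renaming (_≟_ to _≟Q_)
open import Data.Product using (Σ; ∃; _×_; _,_)
open import Relation.Nullary using (¬_; does)
open import Relation.Binary.PropositionalEquality using (_≡_)

record Graph : Set where
  field
    n     : ℕ
    adj   : Fin n → Fin n → Bool
    sym   : ∀ u v → adj u v ≡ adj v u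
    irrefl : ∀ v → adj v v ≡ false
open Graph public

allB : {A : Set} → (A → Bool) → List A → Bool
allB p [] = true
allB p (x ∷ xs) = p x ∧ allB p xs

data Strategy : Set where
  C D : Strategy

isC : Strategy → Bool
isC C = true
isC D = false

isD : Strategy → Bool
isD s = not (isC s)

Config : Graph → Set
Config G = Fin (n G) → Strategy

module _ (G : Graph) where

  inN : Fin (n G) → Fin (n G) → Bool
  inN v u = does (u ≟F v) ∨ adj G v u

  N[_] : Fin (n G) → List (Fin (n G))
  N[ v ] = filterᵇ (inN v) (allFin (n G))

  nC : Config G → Fin (n G) → ℕ
  nC c v = length (filterᵇ (λ u → isC (c u)) N[ v ])

  nD : Config G → Fin (n G) → ℕ
  nD c v = length (filterᵇ (λ u → isD (c u)) N[ v ])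

  -- 1 / m  (and 0 in the impossible case m = 0)
  inv : ℕ → ℚ
  inv zero    = 0ℚ
  inv (suc m) = + 1 / suc m

  -- |N_C[v]| / |N[v]| > 1/2   ⇔   |N[v]| < 2 |N_C[v]|
  majorityC : Config G → Fin (n G) → Bool
  majorityC c v = does (length N[ v ] <? 2 * nC c v)

  power : Config G → Fin (n G) → ℚ
  power c v with c v | majorityC c v
  ... | C | true  = inv (nC c v)
  ... | C | false = 0ℚ
  ... | D | true  = 0ℚ
  ... | D | false = inv (nD c v)

  step : Config G → Config G
  step c v =
    if allB (λ u → isC (c u)) top then C
    else if allB (λ u → isD (c u)) top then D
    else c v
    where
    maxP : ℚ
    maxP = foldr _⊔_ 0ℚ (map (power c) N[ v ])
    top : List (Fin (n G))
    top = filterᵇ (λ u → does (power c u ≟Q maxP)) N[ v ]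

  iter : ℕ → Config G → Config G
  iter zero    c = c
  iter (suc t) c = step (iter t c)

  _≈_ : Config G → Config G → Set
  c ≈ d = ∀ v → c v ≡ d v

  Recurs : Config G → ℕ → Set
  Recurs c₀ ℓ = ∃ λ i → iter i c₀ ≈ iter (i ℕ.+ ℓ) c₀

  PeriodicWithPeriod : Config G → ℕ → Set
  PeriodicWithPeriod c₀ ℓ =
    1 < ℓ × Recurs c₀ ℓ × (∀ m → 1 < m → m < ℓ → ¬ Recurs c₀ m)

module Submission where

-- For every k we build a graph on (8 + k) columns of three vertices arranged
-- in a cycle, and a configuration in which three consecutive columns
-- collaborate and all others defect.  One step of the 1/2-power index process
-- moves this block of collaborators by exactly one column, so the process is
-- a rotation of the cycle and is periodic with period 8 + k.

open import Defs hiding (sym)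
open import Data.Bool using (Bool; true; false; if_then_else_; _∧_; T)
open import Data.Unit using (tt)
open import Data.Bool.Properties using (∧-assoc; ∧-comm; T-∨)
open import Data.Empty using (⊥)
open import Data.Fin as Fin using (Fin; zero; suc; toℕ; fromℕ<; combine; remQuot)
open import Data.Fin.Properties
  using (toℕ-fromℕ<; toℕ-injective; toℕ<n; remQuot-combine; combine-remQuot)
open import Data.List using (List; []; _∷_; map; foldr; length; filterᵇ; allFin)
open import Data.List.Properties using (map-∘; map-cong; length-map)
open import Data.List.Membership.Propositional using (_∈_)
open import Data.List.Membership.Propositional.Properties
  using (∈-filter⁺; ∈-filter⁻; ∈-allFin; ∈-map⁺; ∈-map⁻)
open import Data.List.Membership.Propositional.Properties.WithK using (unique∧set⇒bag)
import Data.List.Membership.DecPropositional as DecMembership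
open import Data.List.Relation.Binary.BagAndSetEquality using (∼bag⇒↭)
open import Data.List.Relation.Binary.Permutation.Propositional as ↭ using (_↭_; prep; swap)
open import Data.List.Relation.Binary.Permutation.Propositional.Properties
  using (map⁺; filter-↭; ↭-length)
open import Data.List.Relation.Unary.All using ([]; _∷_)
open import Data.List.Relation.Unary.All.Properties.Core using (All¬⇒¬Any)
open import Data.List.Relation.Unary.AllPairs using ([]; _∷_)
open import Data.List.Relation.Unary.Any using (here; there)
open import Data.List.Relation.Unary.Unique.Propositional using (Unique)
import Data.List.Relation.Unary.Unique.Propositional.Properties as Unique
open import Data.Nat
  using (ℕ; zero; suc; _+_; _*_; _∸_; _<_; _>_; _≥_; _<ᵇ_; z≤n; s≤s)
open import Data.Nat.DivMod
  using (_%_; m%n<n; m<n⇒m%n≡m; n%n≡0; [m+n]%n≡m%n; [m+kn]%n≡m%n; m%n%n≡m%n; %-distribˡ-+)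
open import Data.Nat.Properties
  using (_<?_; +-comm; *-identityˡ; +-assoc; +-suc; *-suc; m≤n+m; <⇒≢; m<m+n; ≤-antisym; m≤n⇒m<n∨m≡n;
         ≮⇒≥; <-trans; n<1+n; +-cancelʳ-<; +-monoʳ-<; m+[n∸m]≡n; <-irrefl)
open import Data.Product using (Σ; ∃; _×_; _,_; proj₁; proj₂; uncurry)
open import Data.Product.Properties using (≡-dec)
open import Data.Rational using (ℚ; 0ℚ; _/_; _⊔_)
open import Data.Rational.Properties using (⊔-assoc; ⊔-comm) renaming (_≟_ to _≟ℚ_)
open import Data.Sum using (_⊎_; inj₁; inj₂)
open import Data.Integer using (+_)
open import Algebra.Definitions using (Associative; Commutative)
open import Function using (_∘_; Equivalence)
open import Function.Bundles using (mk⇔)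
open import Relation.Nullary using (¬_; Dec; does; yes; no)
open import Relation.Nullary.Decidable using (T?; map′; does-≡; dec-true; dec-false)
open import Relation.Binary.PropositionalEquality
  using (_≡_; _≢_; refl; sym; trans; cong; cong₂; subst; module ≡-Reasoning)

open ≡-Reasoning

-- Counting, folding and
-- universal tests are insensitive to reordering and commute with map; this
-- is what lets a step be computed from a reordered neighbourhood.
count : {A : Set} → (A → Bool) → List A → ℕ
count p xs = length (filterᵇ p xs)

count-map : {A B : Set} (p : B → Bool) (f : A → B) (xs : List A) →
            count (p ∘ f) xs ≡ count p (map f xs)
count-map p f [] = refl
count-map p f (x ∷ xs) with p (f x)
... | true  = cong suc (count-map p f xs)
... | false = count-map p f xs

count-↭ : {A : Set} (p : A → Bool) {xs ys : List A} → xs ↭ ys → count p xs ≡ count p ys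
count-↭ p π = ↭-length (filter-↭ (T? ∘ p) π)

-- A fold with an associative and commutative operation ignores the order of
-- the list (no neutral element is needed, unlike for commutative monoids).
foldr-↭ : {A : Set} {_∙_ : A → A → A} → Associative _≡_ _∙_ → Commutative _≡_ _∙_ →
          (e : A) {xs ys : List A} → xs ↭ ys → foldr _∙_ e xs ≡ foldr _∙_ e ys
foldr-↭ assoc comm e ↭.refl = refl
foldr-↭ {_∙_ = _∙_} assoc comm e (prep x π) = cong (x ∙_) (foldr-↭ assoc comm e π)
foldr-↭ {_∙_ = _∙_} assoc comm e (swap {xs} {ys} x y π) = begin
  x ∙ (y ∙ foldr _∙_ e xs)  ≡⟨ sym (assoc x y (foldr _∙_ e xs)) ⟩
  (x ∙ y) ∙ foldr _∙_ e xs  ≡⟨ cong (_∙ foldr _∙_ e xs) (comm x y) ⟩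
  (y ∙ x) ∙ foldr _∙_ e xs  ≡⟨ assoc y x (foldr _∙_ e xs) ⟩
  y ∙ (x ∙ foldr _∙_ e xs)  ≡⟨ cong (λ z → y ∙ (x ∙ z)) (foldr-↭ assoc comm e π) ⟩
  y ∙ (x ∙ foldr _∙_ e ys)  ∎
foldr-↭ assoc comm e (↭.trans π ρ) = trans (foldr-↭ assoc comm e π) (foldr-↭ assoc comm e ρ)

allB-foldr : {A : Set} (p : A → Bool) (xs : List A) → allB p xs ≡ foldr _∧_ true (map p xs)
allB-foldr p [] = refl
allB-foldr p (x ∷ xs) = cong (p x ∧_) (allB-foldr p xs)

allB-↭ : {A : Set} (p : A → Bool) {xs ys : List A} → xs ↭ ys → allB p xs ≡ allB p ys
allB-↭ p {xs} {ys} π = begin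
  allB p xs                   ≡⟨ allB-foldr p xs ⟩
  foldr _∧_ true (map p xs)   ≡⟨ foldr-↭ ∧-assoc ∧-comm true (map⁺ p π) ⟩
  foldr _∧_ true (map p ys)   ≡⟨ sym (allB-foldr p ys) ⟩
  allB p ys                   ∎

allB-filter-map : {A B : Set} (p q : B → Bool) (f : A → B) (xs : List A) →
                  allB p (filterᵇ q (map f xs)) ≡ allB (p ∘ f) (filterᵇ (q ∘ f) xs)
allB-filter-map p q f [] = refl
allB-filter-map p q f (x ∷ xs) with q (f x)
... | true  = cong (p (f x) ∧_) (allB-filter-map p q f xs)
... | false = allB-filter-map p q f xs

reciprocal : ℕ → ℚ
reciprocal zero    = 0ℚ
reciprocal (suc n) = + 1 / suc n

inv≡reciprocal : (G : Graph) (x : ℕ) → inv G x ≡ reciprocal x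
inv≡reciprocal G zero    = refl
inv≡reciprocal G (suc x) = refl

-- Power of a player from its strategy, whether collaborators are a strict
-- majority around it, and the numbers of collaborators and defectors around it.
powerFrom : Strategy → Bool → ℕ → ℕ → ℚ
powerFrom C true  nc nd = reciprocal nc
powerFrom C false nc nd = 0ℚ
powerFrom D true  nc nd = 0ℚ
powerFrom D false nc nd = reciprocal nd

powerFrom-cong : ∀ s {l l′ x x′ y y′} → l ≡ l′ → x ≡ x′ → y ≡ y′ →
                 powerFrom s (does (l <? 2 * x)) x y ≡ powerFrom s (does (l′ <? 2 * x′)) x′ y′
powerFrom-cong s refl refl refl = refl

localPower : Strategy → List Strategy → ℚ
localPower s ss = powerFrom s (does (length ss <? 2 * count isC ss)) (count isC ss) (count isD ss)

localPower-↭ : ∀ s {ss ts} → ss ↭ ts → localPower s ss ≡ localPower s ts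
localPower-↭ s π = powerFrom-cong s (↭-length π) (count-↭ isC π) (count-↭ isD π)

power-local : (G : Graph) (c : Config G) (v : Fin (n G)) →
              power G c v ≡ localPower (c v) (map c (N[_] G v))
power-local G c v = trans unfold
  (powerFrom-cong (c v) (sym (length-map c N)) (count-map isC c N) (count-map isD c N))
  where
  N = N[_] G v
  unfold : power G c v ≡ powerFrom (c v) (majorityC G c v) (nC G c v) (nD G c v)
  unfold with c v | majorityC G c v
  ... | C | true  = inv≡reciprocal G (nC G c v)
  ... | C | false = refl
  ... | D | true  = refl
  ... | D | false = inv≡reciprocal G (nD G c v)

Observation : Set
Observation = Strategy × ℚ

bestPower : List Observation → ℚ
bestPower os = foldr _⊔_ 0ℚ (map proj₂ os)

leadersAt : ℚ → List Observation → List Observation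
leadersAt q os = filterᵇ (λ o → does (proj₂ o ≟ℚ q)) os

decide : Bool → Bool → Strategy → Strategy
decide allC allD s = if allC then C else if allD then D else s

decideAt : ℚ → List Observation → Strategy → Strategy
decideAt q os = decide (allB (isC ∘ proj₁) (leadersAt q os)) (allB (isD ∘ proj₁) (leadersAt q os))

imitate : List Observation → Strategy → Strategy
imitate os = decideAt (bestPower os) os

imitate-↭ : ∀ {os os′} s → os ↭ os′ → imitate os s ≡ imitate os′ s
imitate-↭ {os} {os′} s π = begin
  decideAt (bestPower os) os s   ≡⟨ cong (λ q → decideAt q os s) best ⟩
  decideAt (bestPower os′) os s  ≡⟨ cong₂ (λ a b → decide a b s) (leaders isC) (leaders isD) ⟩
  decideAt (bestPower os′) os′ s ∎
  where
  best : bestPower os ≡ bestPower os′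
  best = foldr-↭ ⊔-assoc ⊔-comm 0ℚ (map⁺ proj₂ π)
  leaders : ∀ t → allB (t ∘ proj₁) (leadersAt (bestPower os′) os)
                ≡ allB (t ∘ proj₁) (leadersAt (bestPower os′) os′)
  leaders t = allB-↭ (t ∘ proj₁) (filter-↭ (T? ∘ (λ o → does (proj₂ o ≟ℚ bestPower os′))) π)

observe : (G : Graph) → Config G → Fin (n G) → Observation
observe G c u = c u , power G c u

step-as-imitate : (G : Graph) (c : Config G) (v : Fin (n G)) →
                  step G c v ≡ imitate (map (observe G c) (N[_] G v)) (c v)
step-as-imitate G c v = cong₂ (λ a b → decide a b (c v)) (agree isC) (agree isD)
  where
  N = N[_] G v
  maxP = foldr _⊔_ 0ℚ (map (power G c) N)
  best : bestPower (map (observe G c) N) ≡ maxP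
  best = cong (foldr _⊔_ 0ℚ) (sym (map-∘ N))
  agree : ∀ t → allB (t ∘ c) (filterᵇ (λ u → does (power G c u ≟ℚ maxP)) N)
              ≡ allB (t ∘ proj₁) (leadersAt (bestPower (map (observe G c) N)) (map (observe G c) N))
  agree t = sym (trans (cong (λ q → allB (t ∘ proj₁) (leadersAt q (map (observe G c) N))) best)
                       (allB-filter-map (t ∘ proj₁) _ (observe G c) N))

step-local : (G : Graph) (nb : Fin (n G) → List (Fin (n G))) → (∀ v → N[_] G v ↭ nb v) →
             (c : Config G) (v : Fin (n G)) →
             step G c v ≡ imitate (map (λ u → c u , localPower (c u) (map c (nb u))) (nb v)) (c v)
step-local G nb enum c v = begin
  step G c v                                    ≡⟨ step-as-imitate G c v ⟩
  imitate (map (observe G c) (N[_] G v)) (c v)  ≡⟨ imitate-↭ (c v) (map⁺ (observe G c) (enum v)) ⟩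
  imitate (map (observe G c) (nb v)) (c v)      ≡⟨ cong (λ os → imitate os (c v)) (map-cong seen (nb v)) ⟩
  imitate (map (λ u → c u , localPower (c u) (map c (nb u))) (nb v)) (c v) ∎
  where
  seen : ∀ u → observe G c u ≡ (c u , localPower (c u) (map c (nb u)))
  seen u = cong (c u ,_) (trans (power-local G c u) (localPower-↭ (c u) (map⁺ c (enum u))))

N-↭ : (G : Graph) (v : Fin (n G)) (L : List (Fin (n G))) → Unique L →
      (∀ {u} → u ∈ L → T (inN G v u)) → (∀ {u} → T (inN G v u) → u ∈ L) → N[_] G v ↭ L
N-↭ G v L unique-L to from =
  ∼bag⇒↭ (unique∧set⇒bag (Unique.filter⁺ (T? ∘ inN G v) (Unique.allFin⁺ (n G))) unique-L
    (mk⇔ (λ u∈N → from (proj₂ (∈-filter⁻ (T? ∘ inN G v) {xs = allFin (n G)} u∈N)))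
         (λ u∈L → ∈-filter⁺ (T? ∘ inN G v) (∈-allFin _) (to u∈L))))

module Cycle (p : ℕ) where

  m : ℕ
  m = suc p

  shift : ℕ → Fin m → Fin m
  shift d i = fromℕ< (m%n<n (toℕ i + d) m)

  toℕ-shift : ∀ d i → toℕ (shift d i) ≡ (toℕ i + d) % m
  toℕ-shift d i = toℕ-fromℕ< (m%n<n (toℕ i + d) m)

  shift-shift : ∀ a b i → shift a (shift b i) ≡ shift (b + a) i
  shift-shift a b i = toℕ-injective (begin
    toℕ (shift a (shift b i))        ≡⟨ toℕ-shift a (shift b i) ⟩
    (toℕ (shift b i) + a) % m        ≡⟨ cong (λ z → (z + a) % m) (toℕ-shift b i) ⟩
    ((toℕ i + b) % m + a) % m        ≡⟨ %-distribˡ-+ ((toℕ i + b) % m) a m ⟩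
    ((toℕ i + b) % m % m + a % m) % m ≡⟨ cong (λ z → (z + a % m) % m) (m%n%n≡m%n (toℕ i + b) m) ⟩
    ((toℕ i + b) % m + a % m) % m    ≡⟨ sym (%-distribˡ-+ (toℕ i + b) a m) ⟩
    (toℕ i + b + a) % m              ≡⟨ cong (_% m) (+-assoc (toℕ i) b a) ⟩
    (toℕ i + (b + a)) % m            ≡⟨ sym (toℕ-shift (b + a) i) ⟩
    toℕ (shift (b + a) i)            ∎)

  shift-comm : ∀ a b i → shift a (shift b i) ≡ shift b (shift a i)
  shift-comm a b i = begin
    shift a (shift b i)  ≡⟨ shift-shift a b i ⟩
    shift (b + a) i      ≡⟨ cong (λ d → shift d i) (+-comm b a) ⟩
    shift (a + b) i      ≡⟨ sym (shift-shift b a i) ⟩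
    shift b (shift a i)  ∎

  shift-period : ∀ a i → shift (a * m) i ≡ i
  shift-period a i = toℕ-injective (begin
    toℕ (shift (a * m) i)  ≡⟨ toℕ-shift (a * m) i ⟩
    (toℕ i + a * m) % m    ≡⟨ [m+kn]%n≡m%n (toℕ i) a m ⟩
    toℕ i % m              ≡⟨ m<n⇒m%n≡m (toℕ<n i) ⟩
    toℕ i                  ∎)

  shift-cycle : ∀ i → shift m i ≡ i
  shift-cycle i = trans (cong (λ d → shift d i) (sym (*-identityˡ m))) (shift-period 1 i)

  shift-onto : ∀ a z → shift a (shift (a * p) z) ≡ z
  shift-onto a z = begin
    shift a (shift (a * p) z)  ≡⟨ shift-shift a (a * p) z ⟩
    shift (a * p + a) z        ≡⟨ cong (λ d → shift d z) (trans (+-comm (a * p) a) (sym (*-suc a p))) ⟩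
    shift (a * m) z            ≡⟨ shift-period a z ⟩
    z                          ∎

  shift-moves : ∀ {d} → 0 < d → d < m → ∀ i → shift d i ≢ i
  shift-moves {d} 0<d d<m i fixed = by-wrapping (x + d <? m)
    where
    x = toℕ i
    at-x : (x + d) % m ≡ x
    at-x = trans (sym (toℕ-shift d i)) (cong toℕ fixed)
    by-wrapping : Dec (x + d < m) → ⊥
    by-wrapping (yes no-wrap) = <⇒≢ (m<m+n x 0<d) (sym (trans (sym (m<n⇒m%n≡m no-wrap)) at-x))
    by-wrapping (no wrap) = <-irrefl r≡x r<x
      where
      r = x + d ∸ m
      x+d≡r+m : x + d ≡ r + m
      x+d≡r+m = trans (sym (m+[n∸m]≡n (≮⇒≥ wrap))) (+-comm m r)
      r<x : r < x
      r<x = +-cancelʳ-< m r x (subst (_< x + m) x+d≡r+m (+-monoʳ-< x d<m))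
      r≡x : r ≡ x
      r≡x = begin
        r              ≡⟨ sym (m<n⇒m%n≡m (<-trans r<x (toℕ<n i))) ⟩
        r % m          ≡⟨ sym ([m+n]%n≡m%n r m) ⟩
        (r + m) % m    ≡⟨ cong (_% m) (sym x+d≡r+m) ⟩
        (x + d) % m    ≡⟨ at-x ⟩
        x              ∎

  next prev : Fin m → Fin m
  next = shift 1
  prev = shift p

  prev-next : ∀ i → prev (next i) ≡ i
  prev-next i = trans (shift-shift p 1 i) (shift-cycle i)

  next-prev : ∀ i → next (prev i) ≡ i
  next-prev i = trans (shift-comm 1 p i) (prev-next i)

  toℕ-next : ∀ {i x} → toℕ i ≡ x → suc x < m → toℕ (next i) ≡ suc x
  toℕ-next {i} {x} refl x<m = trans (toℕ-shift 1 i) (trans (cong (_% m) (+-comm x 1)) (m<n⇒m%n≡m x<m))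

  toℕ-next-last : ∀ {i} → toℕ i ≡ p → toℕ (next i) ≡ 0
  toℕ-next-last {i} e = begin
    toℕ (next i)     ≡⟨ toℕ-shift 1 i ⟩
    (toℕ i + 1) % m  ≡⟨ cong (λ z → (z + 1) % m) e ⟩
    (p + 1) % m      ≡⟨ cong (_% m) (+-comm p 1) ⟩
    m % m            ≡⟨ n%n≡0 m ⟩
    0                ∎

  toℕ-prev : ∀ {i x} → toℕ i ≡ suc x → toℕ (prev i) ≡ x
  toℕ-prev {i} {x} e = begin
    toℕ (prev i)       ≡⟨ toℕ-shift p i ⟩
    (toℕ i + p) % m    ≡⟨ cong (λ z → (z + p) % m) e ⟩
    (suc x + p) % m    ≡⟨ cong (_% m) (sym (+-suc x p)) ⟩
    (x + m) % m        ≡⟨ [m+n]%n≡m%n x m ⟩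
    x % m              ≡⟨ m<n⇒m%n≡m (<-trans (n<1+n x) (subst (_< m) e (toℕ<n i))) ⟩
    x                  ∎

  toℕ-prev-zero : ∀ {i} → toℕ i ≡ 0 → toℕ (prev i) ≡ p
  toℕ-prev-zero {i} e = trans (toℕ-shift p i) (trans (cong (λ z → (z + p) % m) e) (m<n⇒m%n≡m (n<1+n p)))

pattern α = zero
pattern β = suc zero
pattern γ = suc (suc zero)

module Local {V : Set} (next prev : V → V) where

  Node : Set
  Node = V × Fin 3

  nbrs : Node → List Node
  nbrs (i , α) = (next i , α) ∷ (next i , β) ∷ (next i , γ) ∷ (prev i , α) ∷ []
  nbrs (i , β) = (i , γ) ∷ (next i , β) ∷ (prev i , α) ∷ (prev i , β) ∷ []
  nbrs (i , γ) = (i , β) ∷ (next i , γ) ∷ (prev i , α) ∷ (prev i , γ) ∷ []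

  closed : Node → List Node
  closed x = x ∷ nbrs x

  observeLocal : (V → Strategy) → Node → Observation
  observeLocal h y = h (proj₁ y) , localPower (h (proj₁ y)) (map (h ∘ proj₁) (closed y))

  localStep : (V → Strategy) → Node → Strategy
  localStep h x = imitate (map (observeLocal h) (closed x)) (h (proj₁ x))

  nbrs-sym : (∀ i → prev (next i) ≡ i) → (∀ i → next (prev i) ≡ i) →
             ∀ x y → y ∈ nbrs x → x ∈ nbrs y
  nbrs-sym pn np (i , α) _ (here refl)                         = there (there (there (here (cong (_, α) (sym (pn i))))))
  nbrs-sym pn np (i , α) _ (there (here refl))                 = there (there (here (cong (_, α) (sym (pn i)))))
  nbrs-sym pn np (i , α) _ (there (there (here refl)))         = there (there (here (cong (_, α) (sym (pn i)))))
  nbrs-sym pn np (i , α) _ (there (there (there (here refl)))) = here (cong (_, α) (sym (np i)))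
  nbrs-sym pn np (i , β) _ (here refl)                         = here refl
  nbrs-sym pn np (i , β) _ (there (here refl))                 = there (there (there (here (cong (_, β) (sym (pn i))))))
  nbrs-sym pn np (i , β) _ (there (there (here refl)))         = there (here (cong (_, β) (sym (np i))))
  nbrs-sym pn np (i , β) _ (there (there (there (here refl)))) = there (here (cong (_, β) (sym (np i))))
  nbrs-sym pn np (i , γ) _ (here refl)                         = here refl
  nbrs-sym pn np (i , γ) _ (there (here refl))                 = there (there (there (here (cong (_, γ) (sym (pn i))))))
  nbrs-sym pn np (i , γ) _ (there (there (here refl)))         = there (there (here (cong (_, γ) (sym (np i)))))
  nbrs-sym pn np (i , γ) _ (there (there (there (here refl)))) = there (here (cong (_, γ) (sym (np i))))

  closed-unique : (∀ i → next i ≢ i) → (∀ i → prev i ≢ i) → (∀ i → next i ≢ prev i) →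
                  ∀ x → Unique (closed x)
  closed-unique next≢ prev≢ next≢prev (i , τ) = by-level τ
    where
    apart : ∀ {j j′ : V} {σ σ′ : Fin 3} → j ≢ j′ → (j , σ) ≢ (j′ , σ′)
    apart j≢j′ e = j≢j′ (cong proj₁ e)
    i≢n : ∀ {σ σ′} → (i , σ) ≢ (next i , σ′)
    i≢n = apart (λ e → next≢ i (sym e))
    i≢p : ∀ {σ σ′} → (i , σ) ≢ (prev i , σ′)
    i≢p = apart (λ e → prev≢ i (sym e))
    n≢p : ∀ {σ σ′} → (next i , σ) ≢ (prev i , σ′)
    n≢p = apart (next≢prev i)
    by-level : ∀ τ → Unique (closed (i , τ))
    by-level α = (i≢n ∷ i≢n ∷ i≢n ∷ i≢p ∷ []) ∷ ((λ ()) ∷ (λ ()) ∷ n≢p ∷ []) ∷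
                 ((λ ()) ∷ n≢p ∷ []) ∷ (n≢p ∷ []) ∷ [] ∷ []
    by-level β = ((λ ()) ∷ i≢n ∷ i≢p ∷ i≢p ∷ []) ∷ (i≢n ∷ i≢p ∷ i≢p ∷ []) ∷
                 (n≢p ∷ n≢p ∷ []) ∷ ((λ ()) ∷ []) ∷ [] ∷ []
    by-level γ = ((λ ()) ∷ i≢n ∷ i≢p ∷ i≢p ∷ []) ∷ (i≢n ∷ i≢p ∷ i≢p ∷ []) ∷
                 (n≢p ∷ n≢p ∷ []) ∷ ((λ ()) ∷ []) ∷ [] ∷ []

-- The free set with two unary maps: the columns as seen from a base column.
data Offset : Set where
  origin  : Offset
  fwd bwd : Offset → Offset

-- Values for the seven columns within reach of a local step: two back, one
-- back, the origin, one and two ahead, and the round trips forth-back and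
-- back-forth.
sight : (a₁ a₂ a₃ a₄ a₅ a₆ a₇ : Strategy) → Offset → Strategy
sight a₁ a₂ a₃ a₄ a₅ a₆ a₇ (bwd (bwd origin)) = a₁
sight a₁ a₂ a₃ a₄ a₅ a₆ a₇ (bwd origin)       = a₂
sight a₁ a₂ a₃ a₄ a₅ a₆ a₇ origin             = a₃
sight a₁ a₂ a₃ a₄ a₅ a₆ a₇ (fwd origin)       = a₄
sight a₁ a₂ a₃ a₄ a₅ a₆ a₇ (fwd (fwd origin)) = a₅
sight a₁ a₂ a₃ a₄ a₅ a₆ a₇ (bwd (fwd origin)) = a₆
sight a₁ a₂ a₃ a₄ a₅ a₆ a₇ (fwd (bwd origin)) = a₇
sight a₁ a₂ a₃ a₄ a₅ a₆ a₇ _                  = D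

rule : Fin 3 → (a₁ a₂ a₃ a₄ a₅ a₆ a₇ : Strategy) → Strategy
rule τ a₁ a₂ a₃ a₄ a₅ a₆ a₇ = Local.localStep fwd bwd (sight a₁ a₂ a₃ a₄ a₅ a₆ a₇) (origin , τ)

-- In every model the local step is an instance of the rule: both sides unfold
-- to the same term, since sight names exactly the columns a local step reads.
localStep-rule : {V : Set} (next prev : V → V) (h : V → Strategy) (i : V) (τ : Fin 3) →
  Local.localStep next prev h (i , τ) ≡
  rule τ (h (prev (prev i))) (h (prev i)) (h i) (h (next i)) (h (next (next i)))
         (h (prev (next i))) (h (next (prev i)))
localStep-rule next prev h i α = refl
localStep-rule next prev h i β = refl
localStep-rule next prev h i γ = refl

-- The eight windows of width five in the cyclic word C C C D D … D with at
-- least five D's: the windows around a travelling block of three collaborators.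
data BlockWindow : Strategy → Strategy → Strategy → Strategy → Strategy → Set where
  DDDDD : BlockWindow D D D D D
  CDDDD : BlockWindow C D D D D
  CCDDD : BlockWindow C C D D D
  CCCDD : BlockWindow C C C D D
  DCCCD : BlockWindow D C C C D
  DDCCC : BlockWindow D D C C C
  DDDCC : BlockWindow D D D C C
  DDDDC : BlockWindow D D D D C

-- On such a window (with both round trips returning to the origin) every
-- level copies the column ahead: checked by evaluating the rule.
rule-shifts : ∀ τ {a₁ a₂ a₃ a₄ a₅} → BlockWindow a₁ a₂ a₃ a₄ a₅ → rule τ a₁ a₂ a₃ a₄ a₅ a₃ a₃ ≡ a₄
rule-shifts α DDDDD = refl
rule-shifts α CDDDD = refl
rule-shifts α CCDDD = refl
rule-shifts α CCCDD = refl
rule-shifts α DCCCD = refl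
rule-shifts α DDCCC = refl
rule-shifts α DDDCC = refl
rule-shifts α DDDDC = refl
rule-shifts β DDDDD = refl
rule-shifts β CDDDD = refl
rule-shifts β CCDDD = refl
rule-shifts β CCCDD = refl
rule-shifts β DCCCD = refl
rule-shifts β DDCCC = refl
rule-shifts β DDDCC = refl
rule-shifts β DDDDC = refl
rule-shifts γ DDDDD = refl
rule-shifts γ CDDDD = refl
rule-shifts γ CCDDD = refl
rule-shifts γ CCCDD = refl
rule-shifts γ DCCCD = refl
rule-shifts γ DDCCC = refl
rule-shifts γ DDDCC = refl
rule-shifts γ DDDDC = refl

does-true : {A : Set} (a? : Dec A) → A → T (does a?)
does-true a? a = subst T (sym (dec-true a? a)) tt

does-sound : {A : Set} (a? : Dec A) → T (does a?) → A
does-sound (yes a) _ = a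

-- The column graph on s columns: vertex (i , τ) of Fin s × Fin 3 is numbered
-- combine i τ, and its neighbours are given by the local model.
module ColumnGraph {s : ℕ} (next prev : Fin s → Fin s)
  (prev-next : ∀ i → prev (next i) ≡ i) (next-prev : ∀ i → next (prev i) ≡ i)
  (next≢ : ∀ i → next i ≢ i) (prev≢ : ∀ i → prev i ≢ i) (next≢prev : ∀ i → next i ≢ prev i)
  where

  open Local next prev

  node : Fin (s * 3) → Node
  node = remQuot {s} 3

  index : Node → Fin (s * 3)
  index = uncurry combine

  node-index : ∀ x → node (index x) ≡ x
  node-index (i , τ) = remQuot-combine i τ

  index-node : ∀ u → index (node u) ≡ u
  index-node = combine-remQuot {s} 3

  index-injective : ∀ {x y} → index x ≡ index y → x ≡ y
  index-injective {x} {y} e = trans (sym (node-index x)) (trans (cong node e) (node-index y))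

  column : Fin (s * 3) → Fin s
  column u = proj₁ (node u)

  _≟ₙ_ : (x y : Node) → Dec (x ≡ y)
  _≟ₙ_ = ≡-dec Fin._≟_ Fin._≟_

  open DecMembership _≟ₙ_ using (_∈?_)

  adjacent : Node → Node → Bool
  adjacent x y = does (y ∈? nbrs x)

  unique : ∀ x → Unique (closed x)
  unique = closed-unique next≢ prev≢ next≢prev

  nbrs-irrefl : ∀ x → ¬ x ∈ nbrs x
  nbrs-irrefl x with unique x
  ... | x≢nbrs ∷ _ = All¬⇒¬Any x≢nbrs

  graph : Graph
  graph = record
    { n      = s * 3
    ; adj    = λ u w → adjacent (node u) (node w)
    ; sym    = λ u w → does-≡ (map′ (nbrs-sym prev-next next-prev (node u) (node w))
                                    (nbrs-sym prev-next next-prev (node w) (node u))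
                                    (node w ∈? nbrs (node u)))
                                (node u ∈? nbrs (node w))
    ; irrefl = λ u → dec-false (node u ∈? nbrs (node u)) (nbrs-irrefl (node u))
    }

  enumeration : ∀ v → N[_] graph v ↭ map index (closed (node v))
  enumeration v = N-↭ graph v _ (Unique.map⁺ index-injective (unique (node v))) listed⇒N N⇒listed
    where
    listed⇒N : ∀ {u} → u ∈ map index (closed (node v)) → T (inN graph v u)
    listed⇒N u∈ with ∈-map⁻ index u∈
    ... | _ , here refl , refl = Equivalence.from T-∨ (inj₁ (does-true (index (node v) Fin.≟ v) (index-node v)))
    ... | y , there y∈ , refl = Equivalence.from T-∨ (inj₂ (does-true (node (index y) ∈? nbrs (node v))
                                  (subst (_∈ nbrs (node v)) (sym (node-index y)) y∈)))
    N⇒listed : ∀ {u} → T (inN graph v u) → u ∈ map index (closed (node v))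
    N⇒listed {u} t with Equivalence.to T-∨ t
    ... | inj₁ u≟v = subst (λ w → u ∈ map index (closed (node w))) (does-sound (u Fin.≟ v) u≟v)
                       (subst (_∈ map index (closed (node u))) (index-node u) (here refl))
    ... | inj₂ u-adj = subst (_∈ map index (closed (node v))) (index-node u)
                         (∈-map⁺ index (there (does-sound (node u ∈? nbrs (node v)) u-adj)))

  Columnwise : Config graph → (Fin s → Strategy) → Set
  Columnwise c h = ∀ u → c u ≡ h (column u)

  column-step : ∀ c h → Columnwise c h → ∀ u → step graph c u ≡ localStep h (node u)
  column-step c h c≡h u = begin
    step graph c u                          ≡⟨ step-local graph nb enumeration c u ⟩
    imitate (map seen (nb u)) (c u)         ≡⟨ cong₂ imitate (trans (sym (map-∘ {g = seen} (closed (node u))))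
                                                                    (map-cong seen-local (closed (node u))))
                                                             (c≡h u) ⟩
    localStep h (node u)                    ∎
    where
    nb : Fin (s * 3) → List (Fin (s * 3))
    nb w = map index (closed (node w))
    seen : Fin (s * 3) → Observation
    seen w = c w , localPower (c w) (map c (nb w))
    c-at : ∀ y → c (index y) ≡ h (proj₁ y)
    c-at y = trans (c≡h (index y)) (cong (h ∘ proj₁) (node-index y))
    values : ∀ y → map c (nb (index y)) ≡ map (h ∘ proj₁) (closed y)
    values y = trans (cong (λ x → map c (map index (closed x))) (node-index y))
                     (trans (sym (map-∘ (closed y))) (map-cong c-at (closed y)))
    seen-local : ∀ y → seen (index y) ≡ observeLocal h y
    seen-local y = cong₂ _,_ (c-at y) (cong₂ localPower (c-at y) (values y))

  Window : (Fin s → Strategy) → Fin s → Set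
  Window h i = BlockWindow (h (prev (prev i))) (h (prev i)) (h i) (h (next i)) (h (next (next i)))

  column-travels : ∀ c h → Columnwise c h → ∀ u → Window h (column u) → step graph c u ≡ h (next (column u))
  column-travels c h c≡h u w = begin
    step graph c u                    ≡⟨ column-step c h c≡h u ⟩
    localStep h (i , τ)               ≡⟨ localStep-rule next prev h i τ ⟩
    rule τ a₁ a₂ a₃ a₄ a₅ (h (prev (next i))) (h (next (prev i)))
                                      ≡⟨ cong₂ (rule τ a₁ a₂ a₃ a₄ a₅) (cong h (prev-next i)) (cong h (next-prev i)) ⟩
    rule τ a₁ a₂ a₃ a₄ a₅ a₃ a₃       ≡⟨ rule-shifts τ w ⟩
    h (next i)                        ∎
    where
    i = column u
    τ = proj₂ (node u)
    a₁ = h (prev (prev i))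
    a₂ = h (prev i)
    a₃ = h i
    a₄ = h (next i)
    a₅ = h (next (next i))

module RotatingBlock (k : ℕ) where

  open Cycle (7 + k)

  next≢ : ∀ i → next i ≢ i
  next≢ = shift-moves (s≤s z≤n) (s≤s (s≤s z≤n))

  prev≢ : ∀ i → prev i ≢ i
  prev≢ = shift-moves (s≤s z≤n) (n<1+n (7 + k))

  next≢prev : ∀ i → next i ≢ prev i
  next≢prev i e = shift-moves {2} (s≤s z≤n) (s≤s (s≤s (s≤s z≤n))) i (begin
    shift 2 i       ≡⟨ sym (shift-shift 1 1 i) ⟩
    next (next i)   ≡⟨ cong next e ⟩
    next (prev i)   ≡⟨ next-prev i ⟩
    i               ∎)

  open ColumnGraph next prev prev-next next-prev next≢ prev≢ next≢prev public

  block : ℕ → Strategy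
  block x = if x <ᵇ 3 then C else D

  profile : Fin m → Strategy
  profile j = block (toℕ j)

  C₀ : Config graph
  C₀ u = profile (column u)

  rotated : ℕ → Fin m → Strategy
  rotated t = profile ∘ shift t

  straight-window : ∀ y → BlockWindow (block y) (block (1 + y)) (block (2 + y)) (block (3 + y)) (block (4 + y))
  straight-window 0                   = CCCDD
  straight-window 1                   = CCDDD
  straight-window 2                   = CDDDD
  straight-window (suc (suc (suc y))) = DDDDD

  windowAt : ∀ {j a₁ a₂ a₃ a₄ a₅} →
    toℕ (prev (prev j)) ≡ a₁ → toℕ (prev j) ≡ a₂ → toℕ j ≡ a₃ → toℕ (next j) ≡ a₄ → toℕ (next (next j)) ≡ a₅ →
    BlockWindow (block a₁) (block a₂) (block a₃) (block a₄) (block a₅) → Window profile j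
  windowAt refl refl refl refl refl w = w

  near-end : ∀ y → 2 + y < m → ¬ (4 + y < m) → y ≡ 4 + k ⊎ y ≡ 5 + k
  near-end y (s≤s (s≤s (s≤s y≤5+k))) beyond with ≮⇒≥ beyond
  ... | s≤s (s≤s (s≤s (s≤s 4+k≤y))) with m≤n⇒m<n∨m≡n 4+k≤y
  ...   | inj₂ 4+k≡y  = inj₁ (sym 4+k≡y)
  ...   | inj₁ 5+k≤y  = inj₂ (≤-antisym y≤5+k 5+k≤y)

  profile-windows : ∀ j → Window profile j
  profile-windows j = by-position (toℕ j) refl (toℕ<n j)
    where
    by-position : ∀ x → toℕ j ≡ x → x < m → Window profile j
    by-position 0 e _ =
      let p₁ = toℕ-prev-zero e ; n₁ = toℕ-next e (s≤s (s≤s z≤n))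
      in windowAt (toℕ-prev p₁) p₁ e n₁ (toℕ-next n₁ (s≤s (s≤s (s≤s z≤n)))) DDCCC
    by-position 1 e _ =
      let p₁ = toℕ-prev e ; n₁ = toℕ-next e (s≤s (s≤s (s≤s z≤n)))
      in windowAt (toℕ-prev-zero p₁) p₁ e n₁ (toℕ-next n₁ (s≤s (s≤s (s≤s (s≤s z≤n))))) DCCCD
    by-position (suc (suc y)) e x<m with 4 + y <? m
    ... | yes inside =
      let p₁ = toℕ-prev e ; n₁ = toℕ-next e (<-trans (n<1+n (3 + y)) inside)
      in windowAt (toℕ-prev p₁) p₁ e n₁ (toℕ-next n₁ inside) (straight-window y)
    ... | no beyond with near-end y x<m beyond
    ...   | inj₁ refl =
      let p₁ = toℕ-prev e ; n₁ = toℕ-next e (n<1+n (7 + k))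
      in windowAt (toℕ-prev p₁) p₁ e n₁ (toℕ-next-last n₁) DDDDC
    ...   | inj₂ refl =
      let p₁ = toℕ-prev e ; n₁ = toℕ-next-last e
      in windowAt (toℕ-prev p₁) p₁ e n₁ (toℕ-next n₁ (s≤s (s≤s z≤n))) DDDCC

  -- Shifts commute with next and prev, so rotating moves windows along.
  rotated-windows : ∀ t j → Window (rotated t) j
  rotated-windows t j
    rewrite shift-comm t (7 + k) (prev j) | shift-comm t (7 + k) j
          | shift-comm t 1 (next j) | shift-comm t 1 j
    = profile-windows (shift t j)

  iter-rotates : ∀ t → Columnwise (iter graph t C₀) (rotated t)
  iter-rotates zero u = cong profile (sym (shift-period 0 (column u)))
  iter-rotates (suc t) u = begin
    step graph (iter graph t C₀) u  ≡⟨ column-travels _ (rotated t) (iter-rotates t) u (rotated-windows t (column u)) ⟩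
    rotated t (next (column u))     ≡⟨ cong profile (shift-shift t 1 (column u)) ⟩
    rotated (suc t) (column u)      ∎

  returns : Recurs graph C₀ m
  returns = 0 , λ u → sym (trans (iter-rotates m u) (cong profile (shift-cycle (column u))))

  recurrence-invariant : ∀ t → Recurs graph C₀ t → ∀ z → profile z ≡ profile (shift t z)
  recurrence-invariant t (i , same) z = begin
    profile z                              ≡⟨ cong profile (sym (shift-onto i z)) ⟩
    rotated i y                            ≡⟨ sym (at-column i) ⟩
    iter graph i C₀ (index (y , α))        ≡⟨ same (index (y , α)) ⟩
    iter graph (i + t) C₀ (index (y , α))  ≡⟨ at-column (i + t) ⟩
    rotated (i + t) y                      ≡⟨ cong profile (sym (shift-shift t i y)) ⟩
    profile (shift t (shift i y))          ≡⟨ cong (profile ∘ shift t) (shift-onto i z) ⟩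
    profile (shift t z)                    ∎
    where
    y = shift (i * (7 + k)) z
    at-column : ∀ t′ → iter graph t′ C₀ (index (y , α)) ≡ rotated t′ y
    at-column t′ = trans (iter-rotates t′ (index (y , α))) (cong (rotated t′ ∘ proj₁) (node-index (y , α)))

  C≢D : C ≢ D
  C≢D ()

  -- The profile has no symmetry under a shift 1 < t < m: the image of
  -- column 0 must again collaborate, forcing t = 2, and then column 1 is
  -- sent to the defecting column 3.
  profile-aperiodic : ∀ t → 1 < t → t < m → ¬ (∀ z → profile z ≡ profile (shift t z))
  profile-aperiodic 0 () _
  profile-aperiodic 1 (s≤s ()) _
  profile-aperiodic 2 _ _ invariant =
    C≢D (trans (invariant (suc zero)) (cong block (trans (toℕ-shift 2 (suc zero)) (m<n⇒m%n≡m {n = m} (s≤s (s≤s (s≤s (s≤s z≤n))))))))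
  profile-aperiodic t@(suc (suc (suc _))) _ t<m invariant =
    C≢D (trans (invariant zero) (cong block (trans (toℕ-shift t zero) (m<n⇒m%n≡m t<m))))

  periodic : PeriodicWithPeriod graph C₀ m
  periodic = s≤s (s≤s z≤n) , returns ,
             λ t 1<t t<m recurs → profile-aperiodic t 1<t t<m (recurrence-invariant t recurs)

mainTheorem12 : (k : ℕ) → k > 0 →
    Σ Graph λ G → Σ (Config G) λ C₀ → ∃ λ ℓ → PeriodicWithPeriod G C₀ ℓ × ℓ ≥ k
mainTheorem12 k _ = graph , C₀ , 8 + k , periodic , m≤n+m k 8
  where open RotatingBlock k
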